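{- Let $G=(V,E)$ be a finite graph with at least one vertex and $k>0$ an integer. Then $\mathcal F_k$ is closed under shifting in $\vec S_k$.
   Context: An (oriented vertex) separation of $G$ is a pair $(A,B)$ of (possibly empty) subsets of $V$ with $A\cup B=V$ and no edge of $G$ between $A\setminus B$ and $B\setminus A$; $\vec U$ is the set of these. Order: $(A,B)\le(C,D)$ iff $A\subseteq C$, $B\supseteq D$; inverse $(A,B)^*=(B,A)$; join $(A,B)\vee(C,D)=(A\cup C,B\cap D)$. Unoriented separation $s=\{\vec s,\vec s^{\,*}\}$. Order of $(A,B)$ is $|A\cap B|$; $\vec S_k$ is the set of those of order $<k$, $S_k$ the unoriented ones. A star is a set $\sigma$ of separations with $\vec s\ne\vec s^{\,*}$ for each element and $\vec r\le\vec s^{\,*}$ for all distinct $\vec r,\vec s\in\sigma$. $\mathcal F_k$ is the set of stars $\sigma=\{(A_i,B_i):i=0,\dots,n\}\subseteq\vec U$ with $|\bigcap_{i=0}^nB_i|<k$ (the intersection is $V$ if $\sigma=\emptyset$). Let $\vec S=\vec S_k$. $\vec s$ is degenerate if $\vec s=\vec s^{\,*}$; $\vec r\in\vec S$ is trivial in $\vec S$ if some $s\in S$ satisfies $\vec r<\vec s$ and $\vec r<\vec s^{\,*}$. A set $\mathcal F$ forces $\vec s$ if $\{\vec s^{\,*}\}\in\mathcal F$. $\vec s_0\in\vec S$ emulates $\vec r$ in $\vec S$ if $\vec s_0\ge\vec r$ and $\vec s\vee\vec s_0\in\vec S$ for every $\vec s\in\vec S\setminus\{\vec r^{\,*}\}$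 with $\vec s\ge\vec r$. For nontrivial nondegenerate $\vec r$ and $\vec s_0\ge\vec r$, let $\vec S_{\ge\vec r}$ be the set of all orientations of those $s\in S$ having an orientation $\ge\vec r$, and define the shifting map $f$ on $\vec S_{\ge\vec r}\setminus\{\vec r^{\,*}\}$ by $f(\vec s)=\vec s\vee\vec s_0$ and $f(\vec s^{\,*})=(\vec s\vee\vec s_0)^*$ for $\vec s\ge\vec r$. $\vec s_0$ emulates $\vec r$ in $\vec S$ for $\mathcal F$ if it emulates $\vec r$ in $\vec S$ and $f(\sigma)\in\mathcal F$ for every star $\sigma\subseteq\vec S_{\ge\vec r}\setminus\{\vec r^{\,*}\}$ in $\mathcal F$ having an element $\ge\vec r$. $\mathcal F$ is closed under shifting in $\vec S$ if whenever $\vec s_0\in\vec S$ emulates in $\vec S$ some nontrivial nondegenerate $\vec r\le\vec s_0$ not forced by $\mathcal F$, it does so for $\mathcal F$. -}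

module Defs where

open import Data.Nat using (ℕ; suc; _<_)
open import Data.Fin using (Fin)
open import Data.Fin.Subset using (Subset; _∈_; _∉_; _⊆_; _∪_; _∩_; ⊤; ∣_∣)
open import Data.Fin.Subset.Properties using (_⊆?_)
open import Data.Product using (_×_; _,_; proj₁; proj₂; Σ; ∃)
open import Data.Sum using (_⊎_)
open import Data.List using (List; []; _∷_; map; foldr)
open import Data.List.Membership.Propositional using () renaming (_∈_ to _∈L_)
open import Relation.Nullary using (¬_; yes; no)
open import Relation.Binary.PropositionalEquality using (_≡_; _≢_)
open import Relation.Nullary.Decidable using (_×-dec_)

record Graph (n : ℕ) : Set₁ where
  field
    Adj     : Fin n → Fin n → Set
    sym     : ∀ {x y} → Adj x y → Adj y x
    irrefl  : ∀ {x} → ¬ Adj x x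

Sep : ℕ → Set
Sep n = Subset n × Subset n

module _ {n : ℕ} where

  _≤S_ : Sep n → Sep n → Set
  (A , B) ≤S (C , D) = A ⊆ C × D ⊆ B

  _<S_ : Sep n → Sep n → Set
  r <S s = r ≤S s × r ≢ s

  _* : Sep n → Sep n
  (A , B) * = (B , A)

  _∨S_ : Sep n → Sep n → Sep n
  (A , B) ∨S (C , D) = (A ∪ C , B ∩ D)

  ord : Sep n → ℕ
  ord (A , B) = ∣ A ∩ B ∣

  Degenerate : Sep n → Set
  Degenerate s = s ≡ s *

  -- a (finite) set of separations, represented by a list; all notions below
  -- only depend on list membership
  _∈σ_ : Sep n → List (Sep n) → Set
  s ∈σ σ = s ∈L σ

  Star : List (Sep n) → Set
  Star σ = (∀ s → s ∈σ σ → s ≢ s *)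
         × (∀ r s → r ∈σ σ → s ∈σ σ → r ≢ s → r ≤S (s *))

  ⋂B : List (Sep n) → Subset n
  ⋂B = foldr (λ s X → proj₂ s ∩ X) ⊤

module _ {n : ℕ} (G : Graph n) where
  open Graph G

  IsSep : Sep n → Set
  IsSep (A , B) = (∀ v → v ∈ A ⊎ v ∈ B)
                × (∀ x y → x ∈ A → x ∉ B → y ∈ B → y ∉ A → ¬ Adj x y)

  module _ (k : ℕ) where

    InS : Sep n → Set
    InS s = IsSep s × ord s < k

    InF : List (Sep n) → Set
    InF σ = Star σ × (∀ s → s ∈σ σ → IsSep s) × ∣ ⋂B σ ∣ < k

    Trivial : Sep n → Set
    Trivial r = Σ (Sep n) λ s → InS s × r <S s × r <S (s *)

    Forces : Sep n → Set
    Forces s = InF (s * ∷ [])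

    Emulates : Sep n → Sep n → Set
    Emulates s₀ r = InS s₀ × r ≤S s₀
                  × (∀ s → InS s → s ≢ r * → r ≤S s → InS (s ∨S s₀))

    InS≥∖ : Sep n → Sep n → Set
    InS≥∖ r x = InS x × (r ≤S x ⊎ r ≤S (x *)) × x ≢ r *

    -- shifting map: f(s) = s ∨ s₀ for s ≥ r, f(s*) = (s ∨ s₀)* otherwise
    shift : Sep n → Sep n → Sep n → Sep n
    shift r s₀ x with (proj₁ r ⊆? proj₁ x) ×-dec (proj₂ x ⊆? proj₂ r)
    ... | yes _ = x ∨S s₀
    ... | no  _ = ((x *) ∨S s₀) *

    EmulatesFor : Sep n → Sep n → Set
    EmulatesFor s₀ r = Emulates s₀ r
      × (∀ (σ : List (Sep n)) → (∀ x → x ∈σ σ → InS≥∖ r x) → InF σ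
           → ∃ (λ x → x ∈σ σ × r ≤S x) → InF (map (shift r s₀) σ))

    ClosedUnderShifting : Set
    ClosedUnderShifting = ∀ s₀ r → InS s₀ → InS r → ¬ Trivial r → ¬ Degenerate r
      → r ≤S s₀ → ¬ Forces r → Emulates s₀ r → EmulatesFor s₀ r

-- Since r is not forced, it is not small (r ≰ r*): otherwise {r*} would be a star in 𝓕_k.
-- Consequently a star σ has at most one element s₁ ≥ r (two of them would give
-- r ≤ s₁ ≤ s₂* ≤ r*), and every shifted separation lies above s₀ or below s₀*, hence is
-- nondegenerate; the star relations survive shifting because the join is monotone.
-- For the order bound, enlarge s₁ = (A₁ , B₁) to t = (⋂ₓ (Bₓ ∪ A₁) , B₁): it is a
-- separation ≥ r whose separator lies in ⋂B σ, so t ∈ S⃗_k, and by emulation t ∨ s₀ ∈ S⃗_k;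
-- its separator contains ⋂B f(σ).
module Submission where

open import Defs
open import Data.Nat using (ℕ; suc; _<_)
open import Data.Nat.Properties using (≤-<-trans)
open import Data.Fin.Subset using (Subset; _∈_; _∉_; _⊆_; _∪_; _∩_; ⊤; ⋂; ∣_∣)
open import Data.Fin.Subset.Properties
  using (_⊆?_; _∈?_; ∈⊤; x∈p∩q⁺; x∈p∩q⁻; x∈p∪q⁺; x∈p∪q⁻; p∩q⊆p; p∩q⊆q; p⊆p∪q; q⊆p∪q;
         ⊆-trans; ∩-comm; p⊆q⇒∣p∣≤∣q∣)
open import Data.Product using (_×_; _,_; proj₁; proj₂; ∃; map₁)
open import Data.Sum using (inj₁; inj₂; swap) renaming (map₁ to ⊎-map₁)
open import Data.Empty using (⊥-elim)
open import Data.List using (List; []; _∷_; map)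
open import Data.List.Properties using (foldr-map)
open import Data.List.Relation.Unary.Any using (here; there)
open import Data.List.Membership.Propositional using () renaming (_∈_ to _∈L_)
open import Data.List.Membership.Propositional.Properties using (∈-map⁺; ∈-map⁻)
open import Function using (_∘_; id)
open import Relation.Nullary using (¬_; yes; no)
open import Relation.Nullary.Decidable using (_×-dec_)
open import Relation.Binary.Definitions using (Decidable)
open import Relation.Binary.PropositionalEquality using (_≡_; _≢_; refl; sym; cong; subst)

module _ {n : ℕ} where

  ∪-monoˡ : ∀ {P Q : Subset n} (R : Subset n) → P ⊆ Q → P ∪ R ⊆ Q ∪ R
  ∪-monoˡ {P} R P⊆Q = x∈p∪q⁺ ∘ ⊎-map₁ P⊆Q ∘ x∈p∪q⁻ P R

  ∩-monoˡ : ∀ {P Q : Subset n} (R : Subset n) → P ⊆ Q → P ∩ R ⊆ Q ∩ R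
  ∩-monoˡ {P} R P⊆Q = x∈p∩q⁺ ∘ map₁ P⊆Q ∘ x∈p∩q⁻ P R

  x∈⋂-map⁺ : ∀ {a} {A : Set a} (g : A → Subset n) (as : List A) {v} →
             (∀ {x} → x ∈L as → v ∈ g x) → v ∈ ⋂ (map g as)
  x∈⋂-map⁺ g []       _  = ∈⊤
  x∈⋂-map⁺ g (x ∷ as) v∈ = x∈p∩q⁺ (v∈ (here refl) , x∈⋂-map⁺ g as (v∈ ∘ there))

  x∈⋂-map⁻ : ∀ {a} {A : Set a} (g : A → Subset n) (as : List A) {v x} →
             v ∈ ⋂ (map g as) → x ∈L as → v ∈ g x
  x∈⋂-map⁻ g (y ∷ as) v∈ (here refl) = proj₁ (x∈p∩q⁻ (g y) _ v∈)
  x∈⋂-map⁻ g (y ∷ as) v∈ (there x∈)  = x∈⋂-map⁻ g as (proj₂ (x∈p∩q⁻ (g y) _ v∈)) x∈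

  ⋂B≡⋂-map-proj₂ : (σ : List (Sep n)) → ⋂B σ ≡ ⋂ (map proj₂ σ)
  ⋂B≡⋂-map-proj₂ σ = sym (foldr-map _∩_ proj₂ ⊤ σ)

  x∈⋂B⁺ : ∀ (σ : List (Sep n)) {v} → (∀ {x} → x ∈σ σ → v ∈ proj₂ x) → v ∈ ⋂B σ
  x∈⋂B⁺ σ {v} = subst (v ∈_) (sym (⋂B≡⋂-map-proj₂ σ)) ∘ x∈⋂-map⁺ proj₂ σ

  x∈⋂B⁻ : ∀ (σ : List (Sep n)) {v x} → v ∈ ⋂B σ → x ∈σ σ → v ∈ proj₂ x
  x∈⋂B⁻ σ {v} = x∈⋂-map⁻ proj₂ σ ∘ subst (v ∈_) (⋂B≡⋂-map-proj₂ σ)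

module _ {n : ℕ} where

  separator : Sep n → Subset n
  separator (A , B) = A ∩ B

  ≤S-refl : (s : Sep n) → s ≤S s
  ≤S-refl _ = id , id

  ≤S-trans : ∀ {r s t : Sep n} → r ≤S s → s ≤S t → r ≤S t
  ≤S-trans (A⊆C , D⊆B) (C⊆E , F⊆D) = C⊆E ∘ A⊆C , D⊆B ∘ F⊆D

  *-antitone : ∀ {r s : Sep n} → r ≤S s → (s *) ≤S (r *)
  *-antitone (A⊆C , D⊆B) = D⊆B , A⊆C

  x≤x∨y : (r s : Sep n) → r ≤S (r ∨S s)
  x≤x∨y (A , B) (C , D) = p⊆p∪q C , p∩q⊆p B D

  y≤x∨y : (r s : Sep n) → s ≤S (r ∨S s)
  y≤x∨y (A , B) (C , D) = q⊆p∪q A C , p∩q⊆q B D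

  ∨S-monoˡ : ∀ {r s : Sep n} (t : Sep n) → r ≤S s → (r ∨S t) ≤S (s ∨S t)
  ∨S-monoˡ (E , F) (A⊆C , D⊆B) = ∪-monoˡ E A⊆C , ∩-monoˡ F D⊆B

  _≤S?_ : Decidable (_≤S_ {n})
  (A , B) ≤S? (C , D) = (A ⊆? C) ×-dec (D ⊆? B)

  Small : Sep n → Set
  Small s = s ≤S (s *)

  small-↓ : ∀ {r s : Sep n} → r ≤S s → Small s → Small r
  small-↓ r≤s s-small = ≤S-trans r≤s (≤S-trans s-small (*-antitone r≤s))

  degenerate⇒small : ∀ {s : Sep n} → Degenerate s → Small s
  degenerate⇒small {s} s≡s* = subst (s ≤S_) s≡s* (≤S-refl s)

  singleton-star : ∀ {s : Sep n} → s ≢ s * → Star (s ∷ [])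
  singleton-star s≢s* = nondegenerate , pairwise
    where
    nondegenerate : ∀ x → x ∈σ (_ ∷ []) → x ≢ x *
    nondegenerate x (here refl) = s≢s*
    pairwise : ∀ x y → x ∈σ (_ ∷ []) → y ∈σ (_ ∷ []) → x ≢ y → x ≤S (y *)
    pairwise x y (here refl) (here refl) x≢y = ⊥-elim (x≢y refl)

  star-two-above⇒small : ∀ {σ : List (Sep n)} {r x y} → Star σ → x ∈σ σ → y ∈σ σ → x ≢ y →
                         r ≤S x → r ≤S y → Small r
  star-two-above⇒small (_ , pairwise) x∈ y∈ x≢y r≤x r≤y =
    ≤S-trans r≤x (≤S-trans (pairwise _ _ x∈ y∈ x≢y) (*-antitone r≤y))

  widen : List (Sep n) → Sep n → Sep n
  widen σ (A₁ , B₁) = ⋂ (map (λ x → proj₂ x ∪ A₁) σ) , B₁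

  ≤widen : (σ : List (Sep n)) (s₁ : Sep n) → s₁ ≤S widen σ s₁
  ≤widen σ (A₁ , B₁) = (λ v∈A₁ → x∈⋂-map⁺ _ σ (λ _ → q⊆p∪q _ A₁ v∈A₁)) , id

  separator-widen⊆⋂B : ∀ {σ : List (Sep n)} {s₁} → Star σ → s₁ ∈σ σ →
                       separator (widen σ s₁) ⊆ ⋂B σ
  separator-widen⊆⋂B {σ} {A₁ , B₁} (_ , pairwise) s₁∈ {v} v∈ = x∈⋂B⁺ σ v∈B
    where
    v∈B₁ : v ∈ B₁
    v∈B₁ = proj₂ (x∈p∩q⁻ _ B₁ v∈)

    v∈B : ∀ {x} → x ∈σ σ → v ∈ proj₂ x
    v∈B {x} x∈ with x∈p∪q⁻ (proj₂ x) A₁ (x∈⋂-map⁻ _ σ (proj₁ (x∈p∩q⁻ _ B₁ v∈)) x∈)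
    ... | inj₁ v∈Bx = v∈Bx
    ... | inj₂ v∈A₁ with v ∈? proj₂ x
    ...   | yes v∈Bx = v∈Bx
    ...   | no  v∉Bx = proj₂ (pairwise x _ x∈ s₁∈ x≢s₁) v∈A₁
      where
      x≢s₁ : x ≢ (A₁ , B₁)
      x≢s₁ x≡s₁ = v∉Bx (subst (λ y → v ∈ proj₂ y) (sym x≡s₁) v∈B₁)

module _ {n : ℕ} (G : Graph n) where

  IsSep-* : ∀ {s} → IsSep G s → IsSep G (s *)
  IsSep-* (covers , no-edge) =
    (λ v → swap (covers v)) ,
    (λ x y x∈B x∉A y∈A y∉B adj → no-edge y x y∈A y∉B x∈B x∉A (Graph.sym G adj))

  IsSep-enlargeˡ : ∀ {A B C} → IsSep G (A , B) → A ⊆ C → IsSep G (C , B)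
  IsSep-enlargeˡ {A} {B} {C} (covers , no-edge) A⊆C = ⊎-map₁ A⊆C ∘ covers , no-edge′
    where
    no-edge′ : ∀ x y → x ∈ C → x ∉ B → y ∈ B → y ∉ C → ¬ Graph.Adj G x y
    no-edge′ x y _ x∉B y∈B y∉C with covers x
    ... | inj₁ x∈A = no-edge x y x∈A x∉B y∈B (y∉C ∘ A⊆C)
    ... | inj₂ x∈B = ⊥-elim (x∉B x∈B)

  module _ (k : ℕ) where

    InS-* : ∀ {s} → InS G k s → InS G k (s *)
    InS-* {A , B} (s-sep , s-ord) = IsSep-* s-sep , subst (_< k) (cong ∣_∣ (∩-comm A B)) s-ord

    small⇒forces : ∀ {r} → InS G k r → ¬ Degenerate r → Small r → Forces G k r
    small⇒forces {A , B} (r-sep , r-ord) r-nondeg (A⊆B , _) =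
      singleton-star (r-nondeg ∘ sym) , r*-sep , ≤-<-trans (p⊆q⇒∣p∣≤∣q∣ A∩⊤⊆A∩B) r-ord
      where
      r*-sep : ∀ s → s ∈σ ((B , A) ∷ []) → IsSep G s
      r*-sep _ (here refl) = IsSep-* r-sep
      A∩⊤⊆A∩B : A ∩ ⊤ ⊆ A ∩ B
      A∩⊤⊆A∩B v∈ = let v∈A = p∩q⊆p A ⊤ v∈ in x∈p∩q⁺ (v∈A , A⊆B v∈A)

    module Shifting {r s₀ : Sep n} (r-large : ¬ Small r) (emulates : Emulates G k s₀ r) where

      r≤s₀ : r ≤S s₀
      r≤s₀ = proj₁ (proj₂ emulates)

      join-InS : ∀ s → InS G k s → s ≢ r * → r ≤S s → InS G k (s ∨S s₀)
      join-InS = proj₂ (proj₂ emulates)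

      f : Sep n → Sep n
      f = shift G k r s₀

      -- `r ≤S? x` is the test performed by `shift`, so matching on it computes `f x`.
      f-≥ : ∀ {x} → r ≤S x → f x ≡ x ∨S s₀
      f-≥ {x} r≤x with r ≤S? x
      ... | yes _   = refl
      ... | no  r≰x = ⊥-elim (r≰x r≤x)

      ≥r⇒≢r* : ∀ {s} → r ≤S s → s ≢ r *
      ≥r⇒≢r* r≤s s≡r* = r-large (subst (r ≤S_) s≡r* r≤s)

      ≥s₀⇒nondegenerate : ∀ {s} → s₀ ≤S s → ¬ Degenerate s
      ≥s₀⇒nondegenerate s₀≤s = r-large ∘ small-↓ (≤S-trans r≤s₀ s₀≤s) ∘ degenerate⇒small

      f-nondegenerate : ∀ x → ¬ Degenerate (f x)
      f-nondegenerate x with r ≤S? x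
      ... | yes r≤x = ≥s₀⇒nondegenerate (y≤x∨y x s₀)
      ... | no  r≰x = ≥s₀⇒nondegenerate (y≤x∨y (x *) s₀) ∘ sym

      f-InS : ∀ {x} → InS≥∖ G k r x → InS G k (f x)
      f-InS {x} (x∈S , r≤x⊎r≤x* , x≢r*) with r ≤S? x | r≤x⊎r≤x*
      ... | yes r≤x | _ = join-InS x x∈S x≢r* r≤x
      ... | no  r≰x | inj₁ r≤x = ⊥-elim (r≰x r≤x)
      ... | no  r≰x | inj₂ r≤x* =
        InS-* (join-InS (x *) (InS-* x∈S) x*≢r* r≤x*)
        where
        x*≢r* : x * ≢ r *
        x*≢r* x*≡r* = r≰x (subst (r ≤S_) (cong _* (sym x*≡r*)) (≤S-refl r))

      f-≤* : ∀ {x w} → x ≤S (w *) → ¬ (r ≤S x × r ≤S w) → f x ≤S (f w *)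
      f-≤* {x} {w} x≤w* not-both with r ≤S? x | r ≤S? w
      ... | yes r≤x | yes r≤w = ⊥-elim (not-both (r≤x , r≤w))
      ... | yes r≤x | no  r≰w = ∨S-monoˡ s₀ x≤w*
      ... | no  r≰x | yes r≤w =
        *-antitone (∨S-monoˡ s₀ (*-antitone x≤w*))
      ... | no  r≰x | no  r≰w =
        ≤S-trans (*-antitone (x≤x∨y (x *) s₀)) (≤S-trans x≤w* (x≤x∨y (w *) s₀))

      f-star : ∀ {σ} → Star σ → Star (map f σ)
      f-star {σ} σ-star = nondegenerate , pairwise
        where
        nondegenerate : ∀ y → y ∈σ map f σ → y ≢ y *
        nondegenerate y y∈ with ∈-map⁻ f y∈
        ... | x , _ , refl = f-nondegenerate x

        pairwise : ∀ y z → y ∈σ map f σ → z ∈σ map f σ → y ≢ z → y ≤S (z *)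
        pairwise y z y∈ z∈ y≢z with ∈-map⁻ f y∈ | ∈-map⁻ f z∈
        ... | x , x∈ , refl | w , w∈ , refl =
          f-≤* (proj₂ σ-star x w x∈ w∈ x≢w)
               (λ (r≤x , r≤w) → r-large (star-two-above⇒small σ-star x∈ w∈ x≢w r≤x r≤w))
          where
          x≢w : x ≢ w
          x≢w = y≢z ∘ cong f

      f-B⊆ : ∀ x → proj₂ (f x) ⊆ proj₂ x ∪ proj₁ s₀
      f-B⊆ x with r ≤S? x
      ... | yes r≤x = ⊆-trans (p∩q⊆p (proj₂ x) (proj₂ s₀)) (p⊆p∪q (proj₁ s₀))
      ... | no  r≰x = id

      ⋂B-map-f⊆separator : ∀ {σ s₁} → s₁ ∈σ σ → r ≤S s₁ →
                           ⋂B (map f σ) ⊆ separator (widen σ s₁ ∨S s₀)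
      ⋂B-map-f⊆separator {σ} {s₁} s₁∈ r≤s₁ {v} v∈ = x∈p∩q⁺ (v∈C∪A₀ , v∈B₁∩B₀)
        where
        v∈Bf : ∀ {x} → x ∈σ σ → v ∈ proj₂ (f x)
        v∈Bf x∈ = x∈⋂B⁻ (map f σ) v∈ (∈-map⁺ f x∈)

        v∈B₁∩B₀ : v ∈ proj₂ s₁ ∩ proj₂ s₀
        v∈B₁∩B₀ = subst (λ y → v ∈ proj₂ y) (f-≥ r≤s₁) (v∈Bf s₁∈)

        v∈C∪A₀ : v ∈ proj₁ (widen σ s₁) ∪ proj₁ s₀
        v∈C∪A₀ with v ∈? proj₁ s₀
        ... | yes v∈A₀ = x∈p∪q⁺ (inj₂ v∈A₀)
        ... | no  v∉A₀ = x∈p∪q⁺ (inj₁ (x∈⋂-map⁺ _ σ (p⊆p∪q (proj₁ s₁) ∘ v∈B)))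
          where
          v∈B : ∀ {x} → x ∈σ σ → v ∈ proj₂ x
          v∈B {x} x∈ with x∈p∪q⁻ (proj₂ x) (proj₁ s₀) (f-B⊆ x (v∈Bf x∈))
          ... | inj₁ v∈Bx = v∈Bx
          ... | inj₂ v∈A₀ = ⊥-elim (v∉A₀ v∈A₀)

      f-order : ∀ {σ s₁} → InF G k σ → s₁ ∈σ σ → r ≤S s₁ → ∣ ⋂B (map f σ) ∣ < k
      f-order {σ} {s₁} (σ-star , σ-sep , σ-ord) s₁∈ r≤s₁ =
        ≤-<-trans (p⊆q⇒∣p∣≤∣q∣ (⋂B-map-f⊆separator s₁∈ r≤s₁))
                  (proj₂ (join-InS t t∈S (≥r⇒≢r* r≤t) r≤t))
        where
        t = widen σ s₁
        r≤t : r ≤S t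
        r≤t = ≤S-trans r≤s₁ (≤widen σ s₁)
        t∈S : InS G k t
        t∈S = IsSep-enlargeˡ (σ-sep s₁ s₁∈) (proj₁ (≤widen σ s₁)) ,
              ≤-<-trans (p⊆q⇒∣p∣≤∣q∣ (separator-widen⊆⋂B σ-star s₁∈)) σ-ord

      f-InF : ∀ σ → (∀ x → x ∈σ σ → InS≥∖ G k r x) → InF G k σ →
              ∃ (λ x → x ∈σ σ × r ≤S x) → InF G k (map f σ)
      f-InF σ σ⊆S≥r σ∈F (s₁ , s₁∈ , r≤s₁) =
        f-star (proj₁ σ∈F) , f-sep , f-order σ∈F s₁∈ r≤s₁
        where
        f-sep : ∀ y → y ∈σ map f σ → IsSep G y
        f-sep y y∈ with ∈-map⁻ f y∈
        ... | x , x∈ , refl = proj₁ (f-InS (σ⊆S≥r x x∈))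

lemma6p1 : (m : ℕ) (G : Graph (suc m)) (k : ℕ) → 0 < k → ClosedUnderShifting G k
lemma6p1 _ G k _ s₀ r _ r∈S _ r-nondeg _ r-unforced emulates =
  emulates , Shifting.f-InF G k r-large emulates
  where
  r-large : ¬ Small r
  r-large = r-unforced ∘ small⇒forces G k r∈S r-nondeg
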